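{- Let $G$ be a graph with $|V(G)| \in \{7, \dots, 11\}$ and $\delta(G) \ge 6$. If $G$ is not 4-connected, then $G$ contains $K_5$ as a subgraph. If $G$ is not 5-connected, then $G$ contains $K_5^-$ as a subgraph.
   Context: All graphs are finite and simple. $K_5^-$ denotes $K_5$ with one edge removed. -}

module Defs where

open import Data.Nat using (ℕ; zero; suc; _<_; _≤_)
open import Data.Fin using (Fin; zero; suc)
open import Data.Fin.Subset using (Subset; _∈_; _∉_; ∣_∣)
open import Data.Bool using (Bool; true; false)
open import Data.Vec using (tabulate)
open import Data.List using (List; []; _∷_)
open import Data.Product using (Σ; _×_; _,_; ∃)
open import Data.Sum using (_⊎_)
open import Relation.Binary.PropositionalEquality using (_≡_)
open import Relation.Nullary using (¬_)
open import Function.Definitions using (Injective)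

record Graph (n : ℕ) : Set where
  field
    adj   : Fin n → Fin n → Bool
    sym   : ∀ u v → adj u v ≡ adj v u
    irrefl : ∀ v → adj v v ≡ false
open Graph public

N : ∀ {n} → Graph n → Fin n → Subset n
N G v = tabulate (adj G v)

deg : ∀ {n} → Graph n → Fin n → ℕ
deg G v = ∣ N G v ∣

MinDegGE : ∀ {n} → Graph n → ℕ → Set
MinDegGE G d = ∀ v → d ≤ deg G v

Adj : ∀ {n} → Graph n → Fin n → Fin n → Set
Adj G u v = adj G u v ≡ true

data WalkAvoid {n} (G : Graph n) (S : Subset n) : Fin n → Fin n → Set where
  here : ∀ {u} → u ∉ S → WalkAvoid G S u u
  step : ∀ {u w v} → u ∉ S → Adj G u w → WalkAvoid G S w v → WalkAvoid G S u v

ConnectedMinus : ∀ {n} → Graph n → Subset n → Set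
ConnectedMinus G S = ∀ u v → u ∉ S → v ∉ S → WalkAvoid G S u v

KConnected : ∀ {n} → ℕ → Graph n → Set
KConnected {n} k G = (k < n) × (∀ (S : Subset n) → ∣ S ∣ < k → ConnectedMinus G S)

ContainsK5 : ∀ {n} → Graph n → Set
ContainsK5 {n} G = Σ (Fin 5 → Fin n) λ f →
  Injective _≡_ _≡_ f × (∀ i j → ¬ (i ≡ j) → Adj G (f i) (f j))

-- G contains K5⁻ (K5 minus the edge {0,1}) as a subgraph.
ContainsK5⁻ : ∀ {n} → Graph n → Set
ContainsK5⁻ {n} G = Σ (Fin 5 → Fin n) λ f →
  Injective _≡_ _≡_ f ×
  (∀ i j → ¬ (i ≡ j) → ¬ ((i ≡ zero × j ≡ suc zero) ⊎ (i ≡ suc zero × j ≡ zero)) → Adj G (f i) (f j))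

-- Let u, v ∉ S. Unless a short walk joins them in G − S, their closed neighbourhoods A, B in
-- G − S are disjoint and non-adjacent; δ ≥ 6 gives |S| + |A| ≥ 7 and |S| + |B| ≥ 7, while
-- |S| + |A| + |B| ≤ n ≤ 11. If X is closed in G − S (edges leave X only into S) and |S| + |X| = 7,
-- every x ∈ X has its six neighbours among the six vertices of (X − x) ∪ S, so X is a clique
-- joined to all of S. For |S| ≤ 3 counting forces |S| = 3, |A| = |B| = 4 and S ∪ A ∪ B = V(G),
-- so A is closed and A plus a vertex of S is a K5. For |S| = 4 at most one vertex lies outside
-- S ∪ A ∪ B; if edges left both A and B they would meet there and join u to v, so one of A, B is
-- closed of size 3 and spans a K5⁻ with two vertices of S.

module Submission where

open import Defs hiding (sym)
open import Data.Nat using (zero; suc; _+_; _≤_; _<_; z≤n; s≤s; s≤s⁻¹)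
open import Data.Nat.Properties hiding (_≟_)
open import Data.Nat.Tactic.RingSolver using (solve-∀)
open import Data.Bool using (true)
import Data.Bool.Properties as Bool
open import Data.Fin using (Fin; zero; suc; _≟_)
open import Data.Fin.Properties using (any?)
open import Data.Fin.Subset
open import Data.Fin.Subset.Properties
open import Data.Vec using ([]; _∷_; here; there)
open import Data.Vec.Properties using ([]=⇒lookup; lookup∘tabulate)
open import Data.Vec.Functional using () renaming (_∷_ to _◂_)
open import Data.Product using (Σ-syntax; ∃-syntax; _×_; _,_; proj₁; proj₂)
open import Data.Sum using (_⊎_; inj₁; inj₂; [_,_]′)
import Data.Sum as Sum
open import Function using (_∘_)
open import Function.Definitions using (Injective)
open import Function.Consequences.Propositional using (contraInjective)
open import Relation.Binary.PropositionalEquality using (_≡_; _≢_; refl; sym; trans; cong; cong₂; subst)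
open import Relation.Nullary using (Dec; yes; no; ¬_)
open import Relation.Nullary.Decidable using (decidable-stable; _×-dec_; _⊎-dec_; ¬?)
open import Relation.Nullary.Negation using (contradiction)

x∈p─q⇒x∉q : ∀ {n} {p q : Subset n} {x} → x ∈ p ─ q → x ∉ q
x∈p─q⇒x∉q {p = _ ∷ _} {outside ∷ _} here        ()
x∈p─q⇒x∉q {p = _ ∷ _} {_ ∷ _}       (there x∈) (there x∈q) = x∈p─q⇒x∉q x∈ x∈q

p⊆[p─q]∪q : ∀ {n} (p q : Subset n) → p ⊆ (p ─ q) ∪ q
p⊆[p─q]∪q p q {x} x∈p with x ∈? q
... | yes x∈q = x∈p∪q⁺ (inj₂ x∈q)
... | no  x∉q = x∈p∪q⁺ (inj₁ (x∈p∧x∉q⇒x∈p─q x∈p x∉q))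

∣p∪q∣≤∣p∣+∣q∣ : ∀ {n} (p q : Subset n) → ∣ p ∪ q ∣ ≤ ∣ p ∣ + ∣ q ∣
∣p∪q∣≤∣p∣+∣q∣ []            []            = z≤n
∣p∪q∣≤∣p∣+∣q∣ (inside  ∷ p) (inside  ∷ q) =
  s≤s (≤-trans (∣p∪q∣≤∣p∣+∣q∣ p q) (+-monoʳ-≤ ∣ p ∣ (n≤1+n ∣ q ∣)))
∣p∪q∣≤∣p∣+∣q∣ (inside  ∷ p) (outside ∷ q) = s≤s (∣p∪q∣≤∣p∣+∣q∣ p q)
∣p∪q∣≤∣p∣+∣q∣ (outside ∷ p) (inside  ∷ q) =
  ≤-trans (s≤s (∣p∪q∣≤∣p∣+∣q∣ p q)) (≤-reflexive (sym (+-suc ∣ p ∣ ∣ q ∣)))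
∣p∪q∣≤∣p∣+∣q∣ (outside ∷ p) (outside ∷ q) = ∣p∪q∣≤∣p∣+∣q∣ p q

∣p∪q∣≡∣p∣+∣q∣ : ∀ {n} (p q : Subset n) → Empty (p ∩ q) → ∣ p ∪ q ∣ ≡ ∣ p ∣ + ∣ q ∣
∣p∪q∣≡∣p∣+∣q∣ []            []            _ = refl
∣p∪q∣≡∣p∣+∣q∣ (inside  ∷ p) (inside  ∷ q) e = contradiction (zero , here) e
∣p∪q∣≡∣p∣+∣q∣ (inside  ∷ p) (outside ∷ q) e = cong suc (∣p∪q∣≡∣p∣+∣q∣ p q (drop-∷-Empty e))
∣p∪q∣≡∣p∣+∣q∣ (outside ∷ p) (inside  ∷ q) e =
  trans (cong suc (∣p∪q∣≡∣p∣+∣q∣ p q (drop-∷-Empty e))) (sym (+-suc ∣ p ∣ ∣ q ∣))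
∣p∪q∣≡∣p∣+∣q∣ (outside ∷ p) (outside ∷ q) e = ∣p∪q∣≡∣p∣+∣q∣ p q (drop-∷-Empty e)

∣p∣≤∣p─q∣+∣q∣ : ∀ {n} (p q : Subset n) → ∣ p ∣ ≤ ∣ p ─ q ∣ + ∣ q ∣
∣p∣≤∣p─q∣+∣q∣ p q = ≤-trans (p⊆q⇒∣p∣≤∣q∣ (p⊆[p─q]∪q p q)) (∣p∪q∣≤∣p∣+∣q∣ (p ─ q) q)

x∉p⇒∣p∣<∣p∪⁅x⁆∣ : ∀ {n} {p : Subset n} {x} → x ∉ p → ∣ p ∣ < ∣ p ∪ ⁅ x ⁆ ∣
x∉p⇒∣p∣<∣p∪⁅x⁆∣ {p = p} {x} x∉p =
  p⊂q⇒∣p∣<∣q∣ (p⊆p∪q ⁅ x ⁆ , x , x∈p∪q⁺ (inj₂ (x∈⁅x⁆ x)) , x∉p)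

p⊆q∧∣q∣≤∣p∣⇒q⊆p : ∀ {n} {p q : Subset n} → p ⊆ q → ∣ q ∣ ≤ ∣ p ∣ → q ⊆ p
p⊆q∧∣q∣≤∣p∣⇒q⊆p {p = p} p⊆q ∣q∣≤∣p∣ {x} x∈q with x ∈? p
... | yes x∈p = x∈p
... | no  x∉p = contradiction ∣q∣≤∣p∣ (<⇒≱ (p⊂q⇒∣p∣<∣q∣ (p⊆q , x , x∈q , x∉p)))

contraInjective⇒injective : ∀ {m} {A : Set} {f : Fin m → A} →
  (∀ {i j} → i ≢ j → f i ≢ f j) → Injective _≡_ _≡_ f
contraInjective⇒injective f≢ {i} {j} fi≡fj = decidable-stable (i ≟ j) (λ i≢j → f≢ i≢j fi≡fj)

choose : ∀ {n} k {p : Subset n} → k ≤ ∣ p ∣ →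
  Σ[ f ∈ (Fin k → Fin n) ] Injective _≡_ _≡_ f × (∀ i → f i ∈ p)
choose zero    _ = (λ ()) , (λ { {()} }) , (λ ())
choose {n} (suc k) {p} k<∣p∣ with nonempty? p
... | no  ∄x =
  contradiction (≤-trans k<∣p∣ (≤-reflexive (trans (cong ∣_∣ (Empty-unique ∄x)) (∣⊥∣≡0 n)))) λ ()
... | yes (x , x∈p) with choose k k≤∣p-x∣
  where
  k≤∣p-x∣ : k ≤ ∣ p - x ∣
  k≤∣p-x∣ = s≤s⁻¹ (begin
    suc k                 ≤⟨ k<∣p∣ ⟩
    ∣ p ∣                 ≤⟨ ∣p∣≤∣p─q∣+∣q∣ p ⁅ x ⁆ ⟩
    ∣ p - x ∣ + ∣ ⁅ x ⁆ ∣ ≡⟨ cong (∣ p - x ∣ +_) (∣⁅x⁆∣≡1 x) ⟩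
    ∣ p - x ∣ + 1         ≡⟨ +-comm ∣ p - x ∣ 1 ⟩
    suc ∣ p - x ∣         ∎)
    where open ≤-Reasoning
...   | g , g-injective , g∈p-x = x ◂ g , contraInjective⇒injective distinct , member
  where
  g≢x : ∀ i → g i ≢ x
  g≢x i = x∉⁅y⁆⇒x≢y (x∈p─q⇒x∉q (g∈p-x i))

  distinct : ∀ {i j} → i ≢ j → (x ◂ g) i ≢ (x ◂ g) j
  distinct {zero}  {zero}  0≢0 = contradiction refl 0≢0
  distinct {zero}  {suc j} _   = g≢x j ∘ sym
  distinct {suc i} {zero}  _   = g≢x i
  distinct {suc i} {suc j} i≢j = i≢j ∘ cong suc ∘ g-injective

  member : ∀ i → (x ◂ g) i ∈ p
  member zero    = x∈p
  member (suc i) = p─q⊆p p ⁅ x ⁆ (g∈p-x i)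

∀⊎⇒⊎∀ : ∀ {n} {Q : Fin n → Set} {P : Set} → (∀ i → Q i ⊎ P) → (∀ i → Q i) ⊎ P
∀⊎⇒⊎∀ {zero}  _ = inj₁ λ ()
∀⊎⇒⊎∀ {suc n} h with h zero | ∀⊎⇒⊎∀ (h ∘ suc)
... | inj₂ p  | _       = inj₂ p
... | inj₁ _  | inj₂ p  = inj₂ p
... | inj₁ q₀ | inj₁ qₛ = inj₁ λ { zero → q₀ ; (suc i) → qₛ i }

∀⊎⇒⊎∀-Subset : ∀ {n} {Q : Subset n → Set} {P : Set} → (∀ p → Q p ⊎ P) → (∀ p → Q p) ⊎ P
∀⊎⇒⊎∀-Subset {zero} h with h []
... | inj₁ q = inj₁ λ { [] → q }
... | inj₂ p = inj₂ p
∀⊎⇒⊎∀-Subset {suc n} h with ∀⊎⇒⊎∀-Subset (h ∘ (inside ∷_)) | ∀⊎⇒⊎∀-Subset (h ∘ (outside ∷_))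
... | inj₂ p  | _       = inj₂ p
... | inj₁ _  | inj₂ p  = inj₂ p
... | inj₁ qᵢ | inj₁ qₒ = inj₁ λ { (inside ∷ p) → qᵢ p ; (outside ∷ p) → qₒ p }

x∉p⇒∣p∣<n : ∀ {n} {p : Subset n} {x} → x ∉ p → ∣ p ∣ < n
x∉p⇒∣p∣<n {p = p} {x} x∉p = ≤-trans (x∉p⇒∣p∣<∣p∪⁅x⁆∣ x∉p) (∣p∣≤n (p ∪ ⁅ x ⁆))

x,y∉p⇒2+∣p∣≤n : ∀ {n} {p : Subset n} {x y} → x ∉ p → y ∉ p → x ≢ y → 2 + ∣ p ∣ ≤ n
x,y∉p⇒2+∣p∣≤n {p = p} {x} {y} x∉p y∉p x≢y =
  ≤-trans (s≤s (x∉p⇒∣p∣<∣p∪⁅x⁆∣ x∉p)) (x∉p⇒∣p∣<n y∉p∪⁅x⁆)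
  where
  y∉p∪⁅x⁆ : y ∉ p ∪ ⁅ x ⁆
  y∉p∪⁅x⁆ y∈ with x∈p∪q⁻ p ⁅ x ⁆ y∈
  ... | inj₁ y∈p   = y∉p y∈p
  ... | inj₂ y∈⁅x⁆ = x≢y (sym (x∈⁅y⁆⇒x≡y x y∈⁅x⁆))

m+n≤o+p∧p≤n⇒m≤o : ∀ {m n o p} → m + n ≤ o + p → p ≤ n → m ≤ o
m+n≤o+p∧p≤n⇒m≤o {m} {n} {o} {p} m+n≤o+p p≤n =
  +-cancelʳ-≤ p m o (≤-trans (+-monoʳ-≤ m p≤n) m+n≤o+p)

count-σ≤3 : ∀ {σ a b} → σ ≤ 3 → 7 ≤ σ + a → 7 ≤ σ + b → σ + (a + b) ≤ 11 → σ ≡ 3 × a ≡ 4 × b ≡ 4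
count-σ≤3 {σ} {a} {b} σ≤3 7≤σ+a 7≤σ+b σ+a+b≤11 =
  σ≡3 ,
  ≤-antisym (m+n≤o+p∧p≤n⇒m≤o a+b≤8 4≤b) 4≤a ,
  ≤-antisym (m+n≤o+p∧p≤n⇒m≤o (≤-trans (≤-reflexive (+-comm b a)) a+b≤8) 4≤a) 4≤b
  where
  regroup : ∀ σ a b → (σ + a) + (σ + b) ≡ σ + (σ + (a + b))
  regroup = solve-∀
  σ≡3 : σ ≡ 3
  σ≡3 = ≤-antisym σ≤3 (+-cancelʳ-≤ 11 3 σ (begin
    14                   ≤⟨ +-mono-≤ 7≤σ+a 7≤σ+b ⟩
    (σ + a) + (σ + b)    ≡⟨ regroup σ a b ⟩
    σ + (σ + (a + b))    ≤⟨ +-monoʳ-≤ σ σ+a+b≤11 ⟩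
    σ + 11               ∎))
    where open ≤-Reasoning
  4≤a : 4 ≤ a
  4≤a = +-cancelˡ-≤ 3 4 a (subst (λ s → 7 ≤ s + a) σ≡3 7≤σ+a)
  4≤b : 4 ≤ b
  4≤b = +-cancelˡ-≤ 3 4 b (subst (λ s → 7 ≤ s + b) σ≡3 7≤σ+b)
  a+b≤8 : a + b ≤ 4 + 4
  a+b≤8 = +-cancelˡ-≤ 3 (a + b) 8 (subst (λ s → s + (a + b) ≤ 11) σ≡3 σ+a+b≤11)

module _ {n} (G : Graph n) where

  Adj-sym : ∀ {u v} → Adj G u v → Adj G v u
  Adj-sym {u} {v} uv = trans (Graph.sym G v u) uv

  Adj⇒≢ : ∀ {u v} → Adj G u v → u ≢ v
  Adj⇒≢ {u} uu refl = contradiction (trans (sym uu) (irrefl G u)) λ ()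

  Adj? : ∀ u v → Dec (Adj G u v)
  Adj? u v = adj G u v Bool.≟ true

  ∈N⇒Adj : ∀ {u v} → v ∈ N G u → Adj G u v
  ∈N⇒Adj {u} {v} v∈N = trans (sym (lookup∘tabulate (adj G u) v)) ([]=⇒lookup v∈N)

  IsClique : Subset n → Set
  IsClique P = ∀ {x y} → x ∈ P → y ∈ P → x ≢ y → Adj G x y

  Joined : Subset n → Subset n → Set
  Joined P Q = ∀ {x y} → x ∈ P → y ∈ Q → Adj G x y

  clique-join⇒K5 : ∀ {P Q} → IsClique P → Joined P Q → 4 ≤ ∣ P ∣ → 1 ≤ ∣ Q ∣ → ContainsK5 G
  clique-join⇒K5 clique joined 4≤∣P∣ 1≤∣Q∣ with choose 4 4≤∣P∣ | choose 1 1≤∣Q∣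
  ... | h , h-injective , h∈P | s , _ , s∈Q =
    f , contraInjective⇒injective (λ {i} {j} i≢j → Adj⇒≢ (adjacent i j i≢j)) , adjacent
    where
    f : Fin 5 → Fin n
    f = s zero ◂ h

    adjacent : ∀ i j → i ≢ j → Adj G (f i) (f j)
    adjacent zero    zero    0≢0 = contradiction refl 0≢0
    adjacent zero    (suc j) _   = Adj-sym (joined (h∈P j) (s∈Q zero))
    adjacent (suc i) zero    _   = joined (h∈P i) (s∈Q zero)
    adjacent (suc i) (suc j) i≢j = clique (h∈P i) (h∈P j) (i≢j ∘ cong suc ∘ h-injective)

  clique-join⇒K5⁻ : ∀ {P Q} → IsClique P → Joined P Q → 3 ≤ ∣ P ∣ → 2 ≤ ∣ Q ∣ → ContainsK5⁻ G
  clique-join⇒K5⁻ clique joined 3≤∣P∣ 2≤∣Q∣ with choose 3 3≤∣P∣ | choose 2 2≤∣Q∣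
  ... | h , h-injective , h∈P | s , s-injective , s∈Q =
    f , contraInjective⇒injective distinct , adjacent
    where
    f : Fin 5 → Fin n
    f = s zero ◂ (s (suc zero) ◂ h)

    Missing : Fin 5 → Fin 5 → Set
    Missing i j = (i ≡ zero × j ≡ suc zero) ⊎ (i ≡ suc zero × j ≡ zero)

    adjacent : ∀ i j → i ≢ j → ¬ Missing i j → Adj G (f i) (f j)
    adjacent zero          zero          0≢0 _  = contradiction refl 0≢0
    adjacent zero          (suc zero)    _   ¬m = contradiction (inj₁ (refl , refl)) ¬m
    adjacent (suc zero)    zero          _   ¬m = contradiction (inj₂ (refl , refl)) ¬m
    adjacent (suc zero)    (suc zero)    1≢1 _  = contradiction refl 1≢1
    adjacent zero          (suc (suc j)) _   _  = Adj-sym (joined (h∈P j) (s∈Q zero))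
    adjacent (suc zero)    (suc (suc j)) _   _  = Adj-sym (joined (h∈P j) (s∈Q (suc zero)))
    adjacent (suc (suc i)) zero          _   _  = joined (h∈P i) (s∈Q zero)
    adjacent (suc (suc i)) (suc zero)    _   _  = joined (h∈P i) (s∈Q (suc zero))
    adjacent (suc (suc i)) (suc (suc j)) i≢j _  =
      clique (h∈P i) (h∈P j) (i≢j ∘ cong (λ k → suc (suc k)) ∘ h-injective)

    distinct : ∀ {i j} → i ≢ j → f i ≢ f j
    distinct {i} {j} i≢j with (i ≟ zero ×-dec j ≟ suc zero) ⊎-dec (i ≟ suc zero ×-dec j ≟ zero)
    ... | yes (inj₁ (refl , refl)) = contraInjective s-injective λ ()
    ... | yes (inj₂ (refl , refl)) = contraInjective s-injective λ ()
    ... | no ¬m                    = Adj⇒≢ (adjacent i j i≢j ¬m)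

  K5⇒K5⁻ : ContainsK5 G → ContainsK5⁻ G
  K5⇒K5⁻ (f , f-injective , adjacent) = f , f-injective , λ i j i≢j _ → adjacent i j i≢j

  module _ (S : Subset n) where

    _++ʷ_ : ∀ {u w v} → WalkAvoid G S u w → WalkAvoid G S w v → WalkAvoid G S u v
    here _          ++ʷ q = q
    step u∉S uw p ++ʷ q = step u∉S uw (p ++ʷ q)

    edge-walk : ∀ {u v} → u ∉ S → v ∉ S → Adj G u v → WalkAvoid G S u v
    edge-walk u∉S v∉S uv = step u∉S uv (here v∉S)

    N̄ : Fin n → Subset n
    N̄ u = ⁅ u ⁆ ∪ (N G u ─ S)

    ∈N̄⁻ : ∀ {u x} → x ∈ N̄ u → x ≡ u ⊎ (Adj G u x × x ∉ S)
    ∈N̄⁻ {u} x∈N̄u with x∈p∪q⁻ ⁅ u ⁆ (N G u ─ S) x∈N̄u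
    ... | inj₁ x∈⁅u⁆ = inj₁ (x∈⁅y⁆⇒x≡y u x∈⁅u⁆)
    ... | inj₂ x∈N─S = inj₂ (∈N⇒Adj (p─q⊆p (N G u) S x∈N─S) , x∈p─q⇒x∉q x∈N─S)

    ∈N̄⇒∉S : ∀ {u x} → u ∉ S → x ∈ N̄ u → x ∉ S
    ∈N̄⇒∉S u∉S x∈N̄u with ∈N̄⁻ x∈N̄u
    ... | inj₁ refl          = u∉S
    ... | inj₂ (_ , x∉S)     = x∉S

    N̄-walk : ∀ {u x} → u ∉ S → x ∈ N̄ u → WalkAvoid G S u x
    N̄-walk u∉S x∈N̄u with ∈N̄⁻ x∈N̄u
    ... | inj₁ refl          = here u∉S
    ... | inj₂ (ux , x∉S)    = edge-walk u∉S x∉S ux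

    N̄-walk⁻ : ∀ {u x} → u ∉ S → x ∈ N̄ u → WalkAvoid G S x u
    N̄-walk⁻ u∉S x∈N̄u with ∈N̄⁻ x∈N̄u
    ... | inj₁ refl          = here u∉S
    ... | inj₂ (ux , x∉S)    = edge-walk x∉S u∉S (Adj-sym ux)

    ∣N̄∣≡1+∣N─S∣ : ∀ u → ∣ N̄ u ∣ ≡ suc ∣ N G u ─ S ∣
    ∣N̄∣≡1+∣N─S∣ u =
      trans (∣p∪q∣≡∣p∣+∣q∣ ⁅ u ⁆ (N G u ─ S) ⁅u⁆∩[N─S]≡∅) (cong (_+ ∣ N G u ─ S ∣) (∣⁅x⁆∣≡1 u))
      where
      ⁅u⁆∩[N─S]≡∅ : Empty (⁅ u ⁆ ∩ (N G u ─ S))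
      ⁅u⁆∩[N─S]≡∅ (x , x∈) with x∈p∩q⁻ ⁅ u ⁆ _ x∈
      ... | x∈⁅u⁆ , x∈N─S with x∈⁅y⁆⇒x≡y u x∈⁅u⁆
      ... | refl = Adj⇒≢ (∈N⇒Adj (p─q⊆p (N G u) S x∈N─S)) refl

    minDeg⇒1+d≤∣S∣+∣N̄∣ : ∀ {d} → MinDegGE G d → ∀ u → suc d ≤ ∣ S ∣ + ∣ N̄ u ∣
    minDeg⇒1+d≤∣S∣+∣N̄∣ {d} δ u = begin
      suc d                          ≤⟨ s≤s (δ u) ⟩
      suc (deg G u)                  ≤⟨ s≤s (∣p∣≤∣p─q∣+∣q∣ (N G u) S) ⟩
      suc (∣ N G u ─ S ∣ + ∣ S ∣)    ≡⟨ cong suc (+-comm _ ∣ S ∣) ⟩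
      suc (∣ S ∣ + ∣ N G u ─ S ∣)    ≡⟨ +-suc ∣ S ∣ _ ⟨
      ∣ S ∣ + suc ∣ N G u ─ S ∣      ≡⟨ cong (∣ S ∣ +_) (∣N̄∣≡1+∣N─S∣ u) ⟨
      ∣ S ∣ + ∣ N̄ u ∣                ∎
      where open ≤-Reasoning

    Closed : Subset n → Set
    Closed X = ∀ {x y} → x ∈ X → Adj G x y → y ∉ S → y ∈ X

    closed⇒[X-x]∪S⊆N : ∀ {d X x} → MinDegGE G d → Closed X → ∣ S ∣ + ∣ X ∣ ≤ suc d →
      x ∈ X → (X - x) ∪ S ⊆ N G x
    closed⇒[X-x]∪S⊆N {d} {X} {x} δ closed size x∈X = p⊆q∧∣q∣≤∣p∣⇒q⊆p N⊆ (begin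
      ∣ (X - x) ∪ S ∣      ≤⟨ ∣p∪q∣≤∣p∣+∣q∣ (X - x) S ⟩
      ∣ X - x ∣ + ∣ S ∣    ≤⟨ s≤s⁻¹ (begin
        suc (∣ X - x ∣ + ∣ S ∣) ≤⟨ +-monoˡ-≤ ∣ S ∣ (x∈p⇒∣p-x∣<∣p∣ x∈X) ⟩
        ∣ X ∣ + ∣ S ∣           ≡⟨ +-comm ∣ X ∣ ∣ S ∣ ⟩
        ∣ S ∣ + ∣ X ∣           ≤⟨ size ⟩
        suc d                   ∎) ⟩
      d                    ≤⟨ δ x ⟩
      deg G x              ∎)
      where
      open ≤-Reasoning
      N⊆ : N G x ⊆ (X - x) ∪ S
      N⊆ {y} y∈N with y ∈? S
      ... | yes y∈S = x∈p∪q⁺ (inj₂ y∈S)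
      ... | no  y∉S = x∈p∪q⁺ (inj₁ (x∈p∧x≢y⇒x∈p-y (closed x∈X xy y∉S) (Adj⇒≢ xy ∘ sym)))
        where xy = ∈N⇒Adj y∈N

    closed⇒clique-join : ∀ {d X} → MinDegGE G d → Closed X → ∣ S ∣ + ∣ X ∣ ≤ suc d →
      IsClique X × Joined X S
    closed⇒clique-join {X = X} δ closed size =
      (λ x∈X y∈X x≢y → saturated x∈X (x∈p∪q⁺ (inj₁ (x∈p∧x≢y⇒x∈p-y y∈X (x≢y ∘ sym))))) ,
      (λ x∈X y∈S → saturated x∈X (x∈p∪q⁺ (inj₂ y∈S)))
      where
      saturated : ∀ {x y} → x ∈ X → y ∈ (X - x) ∪ S → Adj G x y
      saturated x∈X y∈ = ∈N⇒Adj (closed⇒[X-x]∪S⊆N δ closed size x∈X y∈)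

    Leak : Subset n → Fin n → Set
    Leak X y = y ∉ S × y ∉ X × ∃[ x ] (x ∈ X × Adj G x y)

    closed-or-leaks : ∀ X → Closed X ⊎ ∃[ y ] Leak X y
    closed-or-leaks X
      with any? (λ y → ¬? (y ∈? S) ×-dec ¬? (y ∈? X) ×-dec any? (λ x → x ∈? X ×-dec Adj? x y))
    ... | yes leak = inj₂ leak
    ... | no ∄leak = inj₁ closed
      where
      closed : Closed X
      closed {x} {y} x∈X xy y∉S with y ∈? X
      ... | yes y∈X = y∈X
      ... | no  y∉X = contradiction (y , y∉S , y∉X , x , x∈X , xy) ∄leak

    Separated : Subset n → Subset n → Set
    Separated A B = ∀ {x y} → x ∈ A → y ∈ B → x ≢ y × ¬ Adj G x y

    walk-or-separated : ∀ {u v} → u ∉ S → v ∉ S → WalkAvoid G S u v ⊎ Separated (N̄ u) (N̄ v)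
    walk-or-separated {u} {v} u∉S v∉S
      with any? (λ x → any? (λ y → x ∈? N̄ u ×-dec y ∈? N̄ v ×-dec (x ≟ y ⊎-dec Adj? x y)))
    ... | yes (x , y , x∈N̄u , y∈N̄v , inj₁ refl) = inj₁ (N̄-walk u∉S x∈N̄u ++ʷ N̄-walk⁻ v∉S y∈N̄v)
    ... | yes (x , y , x∈N̄u , y∈N̄v , inj₂ xy)   =
      inj₁ (N̄-walk u∉S x∈N̄u ++ʷ
           (edge-walk (∈N̄⇒∉S u∉S x∈N̄u) (∈N̄⇒∉S v∉S y∈N̄v) xy ++ʷ N̄-walk⁻ v∉S y∈N̄v))
    ... | no ∄link = inj₂ λ {x} {y} x∈N̄u y∈N̄v →
      (λ x≡y → ∄link (x , y , x∈N̄u , y∈N̄v , inj₁ x≡y)) ,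
      (λ xy  → ∄link (x , y , x∈N̄u , y∈N̄v , inj₂ xy))

    closed⇒K5 : ∀ {X} → MinDegGE G 6 → ∣ S ∣ ≡ 3 → Closed X → ∣ X ∣ ≡ 4 → ContainsK5 G
    closed⇒K5 δ σ≡3 closed ∣X∣≡4 with closed⇒clique-join δ closed (≤-reflexive (cong₂ _+_ σ≡3 ∣X∣≡4))
    ... | clique , joined =
      clique-join⇒K5 clique joined (≤-reflexive (sym ∣X∣≡4)) (≤-trans (s≤s z≤n) (≤-reflexive (sym σ≡3)))

    closed⇒K5⁻ : ∀ {X} → MinDegGE G 6 → ∣ S ∣ ≡ 4 → Closed X → ∣ X ∣ ≡ 3 → ContainsK5⁻ G
    closed⇒K5⁻ δ σ≡4 closed ∣X∣≡3 with closed⇒clique-join δ closed (≤-reflexive (cong₂ _+_ σ≡4 ∣X∣≡3))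
    ... | clique , joined =
      clique-join⇒K5⁻ clique joined (≤-reflexive (sym ∣X∣≡3))
        (≤-trans (s≤s (s≤s z≤n)) (≤-reflexive (sym σ≡4)))

    module SeparatedNeighbourhoods (δ : MinDegGE G 6) (n≤11 : n ≤ 11) {u v} (u∉S : u ∉ S) (v∉S : v ∉ S)
                                   (separated : Separated (N̄ u) (N̄ v)) where

      A B T : Subset n
      A = N̄ u
      B = N̄ v
      T = S ∪ (A ∪ B)

      ∣T∣≡∣S∣+∣A∣+∣B∣ : ∣ T ∣ ≡ ∣ S ∣ + (∣ A ∣ + ∣ B ∣)
      ∣T∣≡∣S∣+∣A∣+∣B∣ =
        trans (∣p∪q∣≡∣p∣+∣q∣ S (A ∪ B) S∩[A∪B]≡∅) (cong (∣ S ∣ +_) (∣p∪q∣≡∣p∣+∣q∣ A B A∩B≡∅))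
        where
        A∩B≡∅ : Empty (A ∩ B)
        A∩B≡∅ (x , x∈A∩B) with x∈p∩q⁻ A B x∈A∩B
        ... | x∈A , x∈B = proj₁ (separated x∈A x∈B) refl
        S∩[A∪B]≡∅ : Empty (S ∩ (A ∪ B))
        S∩[A∪B]≡∅ (x , x∈) with x∈p∩q⁻ S (A ∪ B) x∈
        ... | x∈S , x∈A∪B = [ ∈N̄⇒∉S u∉S , ∈N̄⇒∉S v∉S ]′ (x∈p∪q⁻ A B x∈A∪B) x∈S

      ∉T : ∀ {y} → y ∉ S → y ∉ A → y ∉ B → y ∉ T
      ∉T y∉S y∉A y∉B y∈T = [ y∉S , [ y∉A , y∉B ]′ ∘ x∈p∪q⁻ A B ]′ (x∈p∪q⁻ S (A ∪ B) y∈T)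

      leakA⇒∉T : ∀ {y} → Leak A y → y ∉ T
      leakA⇒∉T (y∉S , y∉A , x , x∈A , xy) = ∉T y∉S y∉A λ y∈B → proj₂ (separated x∈A y∈B) xy

      leakB⇒∉T : ∀ {y} → Leak B y → y ∉ T
      leakB⇒∉T (y∉S , y∉B , x , x∈B , xy) = ∉T y∉S (λ y∈A → proj₂ (separated y∈A x∈B) (Adj-sym xy)) y∉B

      7≤∣S∣+∣N̄∣ : ∀ w → 7 ≤ ∣ S ∣ + ∣ N̄ w ∣
      7≤∣S∣+∣N̄∣ = minDeg⇒1+d≤∣S∣+∣N̄∣ δ

      K5 : ∣ S ∣ ≤ 3 → ContainsK5 G
      K5 σ≤3 with count-σ≤3 σ≤3 (7≤∣S∣+∣N̄∣ u) (7≤∣S∣+∣N̄∣ v)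
                            (subst (_≤ 11) ∣T∣≡∣S∣+∣A∣+∣B∣ (≤-trans (∣p∣≤n T) n≤11))
      ... | σ≡3 , a≡4 , b≡4 = closed⇒K5 δ σ≡3 A-closed a≡4
        where
        ∣T∣≡11 : ∣ T ∣ ≡ 11
        ∣T∣≡11 = trans ∣T∣≡∣S∣+∣A∣+∣B∣ (cong₂ _+_ σ≡3 (cong₂ _+_ a≡4 b≡4))
        ⊤⊆T : ⊤ ⊆ T
        ⊤⊆T = p⊆q∧∣q∣≤∣p∣⇒q⊆p ⊆⊤
          (≤-trans (≤-reflexive (∣⊤∣≡n n)) (≤-trans n≤11 (≤-reflexive (sym ∣T∣≡11))))
        A-closed : Closed A
        A-closed {x} {y} x∈A xy y∉S with x∈p∪q⁻ S (A ∪ B) (⊤⊆T ∈⊤)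
        ... | inj₁ y∈S   = contradiction y∈S y∉S
        ... | inj₂ y∈A∪B =
          [ (λ y∈A → y∈A) , (λ y∈B → contradiction xy (proj₂ (separated x∈A y∈B))) ]′ (x∈p∪q⁻ A B y∈A∪B)

      module _ (σ≡4 : ∣ S ∣ ≡ 4) where

        3≤∣N̄∣ : ∀ w → 3 ≤ ∣ N̄ w ∣
        3≤∣N̄∣ w = +-cancelˡ-≤ 4 3 _ (subst (λ σ → 7 ≤ σ + ∣ N̄ w ∣) σ≡4 (7≤∣S∣+∣N̄∣ w))

        k+∣A∣+∣B∣≤7 : ∀ k → k + ∣ T ∣ ≤ n → k + (∣ A ∣ + ∣ B ∣) ≤ 7
        k+∣A∣+∣B∣≤7 k k+∣T∣≤n = +-cancelˡ-≤ 4 _ 7 (begin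
          4 + (k + (∣ A ∣ + ∣ B ∣))     ≡⟨ +-comm-middle 4 k _ ⟩
          k + (4 + (∣ A ∣ + ∣ B ∣))     ≡⟨ cong (λ σ → k + (σ + (∣ A ∣ + ∣ B ∣))) σ≡4 ⟨
          k + (∣ S ∣ + (∣ A ∣ + ∣ B ∣)) ≡⟨ cong (k +_) ∣T∣≡∣S∣+∣A∣+∣B∣ ⟨
          k + ∣ T ∣                     ≤⟨ k+∣T∣≤n ⟩
          n                             ≤⟨ n≤11 ⟩
          11                            ∎)
          where
          open ≤-Reasoning
          +-comm-middle : ∀ m n o → m + (n + o) ≡ n + (m + o)
          +-comm-middle = solve-∀

        ∉T⇒∣A∣≡3×∣B∣≡3 : ∀ {y} → y ∉ T → ∣ A ∣ ≡ 3 × ∣ B ∣ ≡ 3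
        ∉T⇒∣A∣≡3×∣B∣≡3 y∉T =
          ≤-antisym (m+n≤o+p∧p≤n⇒m≤o a+b≤6 (3≤∣N̄∣ v)) (3≤∣N̄∣ u) ,
          ≤-antisym (m+n≤o+p∧p≤n⇒m≤o (≤-trans (≤-reflexive (+-comm ∣ B ∣ ∣ A ∣)) a+b≤6) (3≤∣N̄∣ u))
                    (3≤∣N̄∣ v)
          where
          a+b≤6 : ∣ A ∣ + ∣ B ∣ ≤ 3 + 3
          a+b≤6 = s≤s⁻¹ (k+∣A∣+∣B∣≤7 1 (x∉p⇒∣p∣<n y∉T))

        K5⁻ : WalkAvoid G S u v ⊎ ContainsK5⁻ G
        K5⁻ with closed-or-leaks A | closed-or-leaks B
        ... | inj₁ A-closed | inj₁ B-closed with ∣ A ∣ ≤? 3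
        ...   | yes a≤3 = inj₂ (closed⇒K5⁻ δ σ≡4 A-closed (≤-antisym a≤3 (3≤∣N̄∣ u)))
        ...   | no  a≰3 = inj₂ (closed⇒K5⁻ δ σ≡4 B-closed (≤-antisym b≤3 (3≤∣N̄∣ v)))
          where
          b≤3 : ∣ B ∣ ≤ 3
          b≤3 = m+n≤o+p∧p≤n⇒m≤o
            (≤-trans (≤-reflexive (+-comm ∣ B ∣ ∣ A ∣)) (k+∣A∣+∣B∣≤7 0 (∣p∣≤n T))) (≰⇒> a≰3)
        K5⁻ | inj₁ A-closed | inj₂ (_ , leak) =
          inj₂ (closed⇒K5⁻ δ σ≡4 A-closed (proj₁ (∉T⇒∣A∣≡3×∣B∣≡3 (leakB⇒∉T leak))))
        K5⁻ | inj₂ (_ , leak) | inj₁ B-closed =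
          inj₂ (closed⇒K5⁻ δ σ≡4 B-closed (proj₂ (∉T⇒∣A∣≡3×∣B∣≡3 (leakA⇒∉T leak))))
        -- Both leaks avoid T, and at most one vertex does.
        K5⁻ | inj₂ (y , leakA) | inj₂ (y′ , leakB) with y ≟ y′
        ... | no y≢y′ = contradiction (≤-trans (+-monoʳ-≤ 2 (+-mono-≤ (3≤∣N̄∣ u) (3≤∣N̄∣ v)))
          (k+∣A∣+∣B∣≤7 2 (x,y∉p⇒2+∣p∣≤n (leakA⇒∉T leakA) (leakB⇒∉T leakB) y≢y′))) (n≮n 7)
        ... | yes refl with leakA | leakB
        ...   | y∉S , _ , x , x∈A , xy | _ , _ , x′ , x′∈B , x′y =
          inj₁ (N̄-walk u∉S x∈A ++ʷ (edge-walk (∈N̄⇒∉S u∉S x∈A) y∉S xy ++ʷ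
               (edge-walk y∉S (∈N̄⇒∉S v∉S x′∈B) (Adj-sym x′y) ++ʷ N̄-walk⁻ v∉S x′∈B)))

    ∣S∣≤3⇒walk⊎K5 : MinDegGE G 6 → n ≤ 11 → ∣ S ∣ ≤ 3 →
      ∀ {u v} → u ∉ S → v ∉ S → WalkAvoid G S u v ⊎ ContainsK5 G
    ∣S∣≤3⇒walk⊎K5 δ n≤11 σ≤3 u∉S v∉S with walk-or-separated u∉S v∉S
    ... | inj₁ walk      = inj₁ walk
    ... | inj₂ separated = inj₂ (SeparatedNeighbourhoods.K5 δ n≤11 u∉S v∉S separated σ≤3)

    ∣S∣≤4⇒walk⊎K5⁻ : MinDegGE G 6 → n ≤ 11 → ∣ S ∣ ≤ 4 →
      ∀ {u v} → u ∉ S → v ∉ S → WalkAvoid G S u v ⊎ ContainsK5⁻ G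
    ∣S∣≤4⇒walk⊎K5⁻ δ n≤11 σ≤4 u∉S v∉S with ∣ S ∣ ≤? 3
    ... | yes σ≤3 = Sum.map₂ K5⇒K5⁻ (∣S∣≤3⇒walk⊎K5 δ n≤11 σ≤3 u∉S v∉S)
    ... | no  σ≰3 with walk-or-separated u∉S v∉S
    ...   | inj₁ walk      = inj₁ walk
    ...   | inj₂ separated =
      SeparatedNeighbourhoods.K5⁻ δ n≤11 u∉S v∉S separated (≤-antisym σ≤4 (≰⇒> σ≰3))

-- Searching the finitely many (S, u, v) turns a failure of k-connectivity into a witness of P.
walk⊎P⇒KConnected⊎P : ∀ {n k} {P : Set} (G : Graph n) → k < n →
  (∀ S → ∣ S ∣ < k → ∀ {u v} → u ∉ S → v ∉ S → WalkAvoid G S u v ⊎ P) → KConnected k G ⊎ P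
walk⊎P⇒KConnected⊎P {k = k} {P} G k<n walk-or =
  Sum.map₁ (λ connected → k<n , λ S ∣S∣<k u v u∉S v∉S → connected S u v (∣S∣<k , u∉S , v∉S))
           (∀⊎⇒⊎∀-Subset λ S → ∀⊎⇒⊎∀ λ u → ∀⊎⇒⊎∀ λ v → attempt S u v)
  where
  attempt : ∀ S u v → ((∣ S ∣ < k × u ∉ S × v ∉ S) → WalkAvoid G S u v) ⊎ P
  attempt S u v with ∣ S ∣ <? k ×-dec ¬? (u ∈? S) ×-dec ¬? (v ∈? S)
  ... | yes (∣S∣<k , u∉S , v∉S) = Sum.map₁ (λ walk _ → walk) (walk-or S ∣S∣<k u∉S v∉S)
  ... | no  ¬premises           = inj₁ (λ premises → contradiction premises ¬premises)

lemma2p6 : ∀ {n} → 7 ≤ n → n ≤ 11 → (G : Graph n) → MinDegGE G 6 →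
    ((¬ KConnected 4 G → ContainsK5 G) × (¬ KConnected 5 G → ContainsK5⁻ G))
lemma2p6 {n} 7≤n n≤11 G δ =
  resolve (walk⊎P⇒KConnected⊎P G (≤-trans (m≤m+n 5 2) 7≤n)
    λ S ∣S∣<4 → ∣S∣≤3⇒walk⊎K5 G S δ n≤11 (s≤s⁻¹ ∣S∣<4)) ,
  resolve (walk⊎P⇒KConnected⊎P G (≤-trans (n≤1+n 6) 7≤n)
    λ S ∣S∣<5 → ∣S∣≤4⇒walk⊎K5⁻ G S δ n≤11 (s≤s⁻¹ ∣S∣<5))
  where
  resolve : ∀ {k} {P : Set} → KConnected k G ⊎ P → ¬ KConnected k G → P
  resolve (inj₁ connected) ¬connected = contradiction connected ¬connected
  resolve (inj₂ p)         _          = p
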